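{- Let $n \geq 3$ be an integer. There exist $n-1$ edge-disjoint spanning trees in the $n$-dimensional augmented cube $AQ_n$.
   Context: The $n$-dimensional augmented cube $AQ_n$ ($n\ge 1$) is the graph on $2^n$ vertices labeled by $n$-bit binary strings $u=u_1u_2\cdots u_n$, defined recursively: $AQ_1$ is $K_2$ on vertex set $\{0,1\}$. For $n\ge 2$, $AQ_n$ consists of two copies $AQ^0_{n-1}$ (vertices $0u_2\cdots u_n$) and $AQ^1_{n-1}$ (vertices $1v_2\cdots v_n$) of $AQ_{n-1}$ (with the first bit prepended), together with $2^n$ additional edges: a vertex $u=0u_2\cdots u_n$ is joined to $v=1v_2\cdots v_n$ if and only if either $u_i=v_i$ for all $2\le i\le n$ (a hypercube edge), or $u_i=\overline{v_i}$ for all $2\le i\le n$ (a complement edge). A spanning tree of a graph $G$ is a tree $T\subseteq G$ with $V(T)=V(G)$; spanning trees $T_1,\dots,T_k$ are edge-disjoint if their edge sets are pairwise disjoint. -}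

module Defs where

open import Data.Nat using (ℕ; zero; suc)
open import Data.Fin using (Fin)
open import Data.Bool using (Bool; true; false; not)
open import Data.Vec using (Vec; []; _∷_; map)
open import Data.List using (List; []; _∷_; _∷ʳ_)
open import Data.List.Relation.Unary.Linked using (Linked)
open import Data.List.Relation.Unary.Unique.Propositional using (Unique)
open import Data.Product using (_×_; Σ; ∃)
open import Data.Sum using (_⊎_)
open import Data.Empty using (⊥)
open import Relation.Binary.PropositionalEquality using (_≡_; _≢_)
open import Relation.Binary.Construct.Closure.ReflexiveTransitive using (Star)

-- Vertices of AQ_n : n-bit binary strings u₁u₂⋯uₙ (head of the vector = u₁).
Vertex : ℕ → Set
Vertex n = Vec Bool n

AQ-Adj : (n : ℕ) → Vertex n → Vertex n → Set
AQ-Adj zero    []      []      = ⊥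
AQ-Adj (suc n) (b ∷ u) (c ∷ v) =
  (b ≡ c × AQ-Adj n u v) ⊎ (b ≢ c × (u ≡ v ⊎ u ≡ map not v))

-- A (spanning) subgraph of AQ_n given by its edge relation: symmetric, and
-- every edge is an edge of AQ_n.  Its vertex set is all of V(AQ_n).
record SpanningSubgraph (n : ℕ) : Set₁ where
  field
    E       : Vertex n → Vertex n → Set
    sym     : ∀ u v → E u v → E v u
    edgesOK : ∀ u v → E u v → AQ-Adj n u v
open SpanningSubgraph public

Connected : ∀ {n} → SpanningSubgraph n → Set
Connected {n} T = (u v : Vertex n) → Star (E T) u v

Cycle : ∀ {n} → SpanningSubgraph n → Set
Cycle {n} T =
  Σ (Vertex n) λ a → Σ (Vertex n) λ b → Σ (Vertex n) λ c → Σ (List (Vertex n)) λ rest →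
    Unique (a ∷ b ∷ c ∷ rest) × Linked (E T) ((a ∷ b ∷ c ∷ rest) ∷ʳ a)

Acyclic : ∀ {n} → SpanningSubgraph n → Set
Acyclic T = Cycle T → ⊥

IsSpanningTree : ∀ {n} → SpanningSubgraph n → Set
IsSpanningTree T = Connected T × Acyclic T

EdgeDisjoint : ∀ {n k} → (Fin k → SpanningSubgraph n) → Set
EdgeDisjoint {n} {k} T =
  (i j : Fin k) → i ≢ j → (u v : Vertex n) → E (T i) u v → E (T j) u v → ⊥

module Submission where

-- Change coordinates by the difference map  toDiff x = y,  y₀ = x₀ and
-- yⱼ = xⱼ₋₁ xor xⱼ  (a bijection).  Complementing the suffix xᵢ⋯xₙ₋₁ (a
-- complement edge of AQ_n) flips the single bit yᵢ, and flipping the single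
-- bit xᵢ (a hypercube edge) flips the pair yᵢ, yᵢ₊₁.
--
-- For each k with k + 1 < n the tree T_k is given by a parent function on y:
--   * if y_k = 0, the parent flips the pair y_k, y_{k+1} (a "pair link");
--   * if y_k = 1, the parent clears the first set bit i ≠ k met when scanning
--     cyclically upward from k + 1 (a "bit link"); if there is none, y = e_k
--     is the root.
-- The rank  popcount(y) + 3·[y_k = 0]  strictly decreases along parents, and a
-- parent function with a decreasing rank and a single orphan always defines a
-- spanning tree (module ParentTree, proved first for an arbitrary vertex type).
-- Edge-disjointness: pair links of different trees flip different pairs, and
-- a bit link flipping bit i lies in T_k only if y_k = 1 and no bit strictly
-- between k and i (cyclically) is set; for k ≠ k' these demands clash.

open import Defs hiding (sym)
open import Data.Nat using (ℕ; zero; suc; _+_; _∸_; _≤_; _<_; z≤n; s≤s; _≟_; _<?_)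
open import Data.Nat.Properties
  using (≤-refl; ≤-trans; <-trans; <-irrefl; <-asym; <-cmp; <⇒≤; ≤⇒≯; ≮⇒≥; ≤∧≢⇒<;
         n<1+n; n≤1+n; 1+n≢n; m≢1+n+m; m<m+n; +-suc; +-comm; +-identityʳ; m+[n∸m]≡n; module ≤-Reasoning)
open import Data.Bool using (Bool; true; false; not; _xor_; if_then_else_)
open import Data.Bool.Properties
  using (not-involutive; not-¬; xor-assoc; xor-same; not-distribˡ-xor; not-distribʳ-xor)
open import Data.Vec using (Vec; []; _∷_; map; replicate)
open import Data.Vec.Properties using (map-∘; map-cong; map-id)
open import Data.Maybe using (Maybe; just; nothing; _<∣>_)
import Data.Maybe as Maybe
open import Data.Maybe.Properties using (just-injective)
open import Data.List using (List; []; _∷_; _++_; _∷ʳ_)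
open import Data.List.Relation.Unary.All using (All; []; _∷_)
import Data.List.Relation.Unary.All as All
open import Data.List.Relation.Unary.AllPairs using (AllPairs; []; _∷_)
open import Data.List.Relation.Unary.Linked using (Linked; []; [-]; _∷_)
open import Data.List.Relation.Unary.Unique.Propositional using (Unique)
open import Data.Fin using (Fin; toℕ)
open import Data.Fin.Properties using (toℕ<n; toℕ-injective)
open import Data.Product using (Σ; _×_; _,_; proj₂)
open import Data.Sum using (_⊎_; inj₁; inj₂; swap)
open import Data.Empty using (⊥; ⊥-elim)
open import Data.Unit using (⊤; tt)
open import Relation.Nullary using (yes; no)
open import Relation.Binary using (tri<; tri≈; tri>)
open import Relation.Binary.PropositionalEquality
  using (_≡_; _≢_; refl; sym; trans; cong; cong₂; subst; ≢-sym; module ≡-Reasoning)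
open import Relation.Binary.Construct.Closure.ReflexiveTransitive
  using (Star; ε; _◅_; _◅◅_; reverse)

module Walks {A : Set} where

  NoBacktrack : List A → Set
  NoBacktrack (x ∷ y ∷ z ∷ zs) = x ≢ z × NoBacktrack (y ∷ z ∷ zs)
  NoBacktrack _                = ⊤

  endpoint : A → List A → A
  endpoint x []       = x
  endpoint _ (y ∷ ys) = endpoint y ys

  endpoint-++ : ∀ x ys u us → endpoint x (ys ++ u ∷ us) ≡ endpoint u us
  endpoint-++ x []       u us = refl
  endpoint-++ x (y ∷ ys) u us = endpoint-++ y ys u us

  linked-extend : ∀ {R : A → A → Set} x ys u w →
                  Linked R (x ∷ ys ++ u ∷ []) → R u w → Linked R (x ∷ ys ++ u ∷ w ∷ [])
  linked-extend x []       u w (x~u ∷ [-]) u~w = x~u ∷ u~w ∷ [-]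
  linked-extend x (y ∷ ys) u w (x~y ∷ walk) u~w = x~y ∷ linked-extend y ys u w walk u~w

  distinct-nb-∷ʳ : ∀ x y zs u → AllPairs _≢_ (x ∷ y ∷ zs) → All (_≢ u) (x ∷ y ∷ zs) →
                   NoBacktrack (x ∷ y ∷ zs ++ u ∷ [])
  distinct-nb-∷ʳ x y []       u _ (x≢u ∷ _) = x≢u , tt
  distinct-nb-∷ʳ x y (z ∷ zs) u ((_ ∷ x≢z ∷ _) ∷ distinct) (_ ∷ ≢u) =
    x≢z , distinct-nb-∷ʳ y z zs u distinct ≢u

  distinct-nb-∷ʳ₂ : ∀ x y zs u w → AllPairs _≢_ (x ∷ y ∷ zs) → All (_≢ u) (x ∷ y ∷ zs) →
                    All (_≢ w) (y ∷ zs) → NoBacktrack (x ∷ y ∷ zs ++ u ∷ w ∷ [])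
  distinct-nb-∷ʳ₂ x y []       u w _ (x≢u ∷ _) (y≢w ∷ _) = x≢u , y≢w , tt
  distinct-nb-∷ʳ₂ x y (z ∷ zs) u w ((_ ∷ x≢z ∷ _) ∷ distinct) (_ ∷ ≢u) (_ ∷ ≢w) =
    x≢z , distinct-nb-∷ʳ₂ y z zs u w distinct ≢u ≢w

open Walks

module ParentTree {V : Set} (parent : V → Maybe V) (rank : V → ℕ) (root : V)
  (rank-decreases : ∀ {u v} → parent u ≡ just v → rank v < rank u)
  (orphan-is-root : ∀ u → parent u ≡ nothing → u ≡ root) where

  _↦_ : V → V → Set
  u ↦ v = parent u ≡ just v

  Edge : V → V → Set
  Edge u v = u ↦ v ⊎ v ↦ u

  Edge-sym : ∀ u v → Edge u v → Edge v u
  Edge-sym _ _ = swap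

  parent-unique : ∀ {u v w} → u ↦ v → u ↦ w → v ≡ w
  parent-unique p q = just-injective (trans (sym p) q)

  path-to-root : ∀ bound u → rank u < bound → Star Edge u root
  path-to-root (suc bound) u (s≤s rank≤bound) with parent u in u↦
  ... | just v  = inj₁ u↦ ◅ path-to-root bound v (≤-trans (rank-decreases u↦) rank≤bound)
  ... | nothing = subst (λ w → Star Edge w root) (sym (orphan-is-root u u↦)) ε

  connected : ∀ u v → Star Edge u v
  connected u v = path-to-root (suc (rank u)) u ≤-refl
               ◅◅ reverse (Edge-sym _ _) (path-to-root (suc (rank v)) v ≤-refl)

  -- A non-backtracking walk whose first step goes from a parent down to its
  -- child continues downward (stepping up would return to that parent),
  -- so the rank strictly increases along it.
  ascending : ∀ x y zs → Linked Edge (x ∷ y ∷ zs) → NoBacktrack (x ∷ y ∷ zs) →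
              y ↦ x → rank x < rank (endpoint y zs)
  ascending x y []       _ _ y↦x = rank-decreases y↦x
  ascending x y (z ∷ zs) (_ ∷ inj₁ y↦z ∷ _) (x≢z , _) y↦x =
    ⊥-elim (x≢z (parent-unique y↦x y↦z))
  ascending x y (z ∷ zs) (_ ∷ walk@(inj₂ z↦y ∷ _)) (_ , nb) y↦x =
    <-trans (rank-decreases y↦x) (ascending y z zs walk nb z↦y)

  EndsUpward : V → List V → Set
  EndsUpward _ []           = ⊥
  EndsUpward x (y ∷ [])     = x ↦ y
  EndsUpward _ (y ∷ z ∷ zs) = EndsUpward y (z ∷ zs)

  endsUpward-++ : ∀ x ys u w → u ↦ w → EndsUpward x (ys ++ u ∷ w ∷ [])
  endsUpward-++ x []           u w u↦w = u↦w
  endsUpward-++ x (y ∷ [])     u w u↦w = u↦w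
  endsUpward-++ x (y ∷ z ∷ zs) u w u↦w = endsUpward-++ y (z ∷ zs) u w u↦w

  -- Dually, a non-backtracking walk that ends upward went upward all along,
  -- so the rank strictly decreases along it.
  descending : ∀ x y zs → Linked Edge (x ∷ y ∷ zs) → NoBacktrack (x ∷ y ∷ zs) →
               EndsUpward x (y ∷ zs) → x ↦ y × rank (endpoint y zs) < rank x
  descending x y []       _ _ x↦y = x↦y , rank-decreases x↦y
  descending x y (z ∷ zs) (x~y ∷ walk) (x≢z , nb) up with descending y z zs walk nb up
  ... | y↦z , end<y with x~y
  ...   | inj₁ x↦y = x↦y , <-trans end<y (rank-decreases x↦y)
  ...   | inj₂ y↦x = ⊥-elim (x≢z (parent-unique y↦x y↦z))

  -- A cycle a b c ⋯ a: if its first step goes down, the whole cycle goes down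
  -- (rank a < rank a); if it goes up, then so does the rotated cycle
  -- b c ⋯ a b, whose last step a → b is upward (rank b < rank b).
  acyclic : ∀ a b c rest → Unique (a ∷ b ∷ c ∷ rest) →
            Linked Edge ((a ∷ b ∷ c ∷ rest) ∷ʳ a) → ⊥
  acyclic a b c rest ((a≢b ∷ a≢c ∷ a≢rest) ∷ distinct@((b≢c ∷ b≢rest) ∷ _)) (a~b ∷ walk-b)
    with a~b
  ... | inj₂ b↦a =
        <-irrefl (cong rank (sym (endpoint-++ b (c ∷ rest) a [])))
                 (ascending a b ((c ∷ rest) ∷ʳ a) (a~b ∷ walk-b) (a≢c , nb-b) b↦a)
    where nb-b : NoBacktrack (b ∷ c ∷ rest ++ a ∷ [])
          nb-b = distinct-nb-∷ʳ b c rest a distinct (All.map ≢-sym (a≢b ∷ a≢c ∷ a≢rest))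
  ... | inj₁ a↦b =
        <-irrefl (cong rank (endpoint-++ c rest a (b ∷ [])))
                 (proj₂ (descending b c (rest ++ a ∷ b ∷ [])
                          (linked-extend b (c ∷ rest) a b walk-b (inj₁ a↦b))
                          (distinct-nb-∷ʳ₂ b c rest a b distinct
                             (All.map ≢-sym (a≢b ∷ a≢c ∷ a≢rest)) (All.map ≢-sym (b≢c ∷ b≢rest)))
                          (endsUpward-++ b (c ∷ rest) a b a↦b)))

-- Bit j of a string, read as 0 beyond its length.
_!_ : ∀ {n} → Vec Bool n → ℕ → Bool
[]      ! _     = false
(b ∷ _) ! zero  = b
(_ ∷ v) ! suc j = v ! j

-- Flip bit i (no effect beyond the length).
toggle : ∀ {n} → ℕ → Vec Bool n → Vec Bool n
toggle _       []      = []
toggle zero    (b ∷ v) = not b ∷ v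
toggle (suc i) (b ∷ v) = b ∷ toggle i v

toggle-here : ∀ {n} i (y : Vec Bool n) → i < n → toggle i y ! i ≡ not (y ! i)
toggle-here zero    (b ∷ y) _         = refl
toggle-here (suc i) (b ∷ y) (s≤s i<n) = toggle-here i y i<n

toggle-there : ∀ {n} i j (y : Vec Bool n) → i ≢ j → toggle i y ! j ≡ y ! j
toggle-there i       j       []      _   = refl
toggle-there zero    zero    (b ∷ y) i≢j = ⊥-elim (i≢j refl)
toggle-there zero    (suc j) (b ∷ y) _   = refl
toggle-there (suc i) zero    (b ∷ y) _   = refl
toggle-there (suc i) (suc j) (b ∷ y) i≢j = toggle-there i j y (λ i≡j → i≢j (cong suc i≡j))

toggle-involutive : ∀ {n} i (y : Vec Bool n) → toggle i (toggle i y) ≡ y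
toggle-involutive i       []      = refl
toggle-involutive zero    (b ∷ y) = cong (_∷ y) (not-involutive b)
toggle-involutive (suc i) (b ∷ y) = cong (b ∷_) (toggle-involutive i y)

toggle-comm : ∀ {n} i j (y : Vec Bool n) → toggle i (toggle j y) ≡ toggle j (toggle i y)
toggle-comm i       j       []      = refl
toggle-comm zero    zero    (b ∷ y) = refl
toggle-comm zero    (suc j) (b ∷ y) = refl
toggle-comm (suc i) zero    (b ∷ y) = refl
toggle-comm (suc i) (suc j) (b ∷ y) = cong (b ∷_) (toggle-comm i j y)

!-beyond : ∀ {n} (y : Vec Bool n) j → n ≤ j → y ! j ≡ false
!-beyond []      j       _         = refl
!-beyond (b ∷ y) (suc j) (s≤s n≤j) = !-beyond y j n≤j

!-zeros : ∀ n j → replicate n false ! j ≡ false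
!-zeros zero    j       = refl
!-zeros (suc n) zero    = refl
!-zeros (suc n) (suc j) = !-zeros n j

!-ext : ∀ {n} (u v : Vec Bool n) → (∀ j → u ! j ≡ v ! j) → u ≡ v
!-ext []      []      _    = refl
!-ext (a ∷ u) (b ∷ v) same = cong₂ _∷_ (same zero) (!-ext u v (λ j → same (suc j)))

differ-at : ∀ {n} {u v : Vec Bool n} {b} j → u ! j ≡ not b → v ! j ≡ b → u ≢ v
differ-at j u-j v-j u≡v = not-¬ refl (trans (sym v-j) (trans (cong (_! j) (sym u≡v)) u-j))

toggle-injective : ∀ {n} i i' (y : Vec Bool n) → i < n → toggle i y ≡ toggle i' y → i ≡ i'
toggle-injective i i' y i<n same with i ≟ i'
... | yes i≡i' = i≡i'
... | no  i≢i' = ⊥-elim (differ-at i (toggle-here i y i<n) (toggle-there i' i y (≢-sym i≢i')) same)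

weight : ∀ {n} → Vec Bool n → ℕ
weight []          = 0
weight (true ∷ v)  = suc (weight v)
weight (false ∷ v) = weight v

weight-toggle-set : ∀ {n} i (y : Vec Bool n) → y ! i ≡ true → suc (weight (toggle i y)) ≡ weight y
weight-toggle-set zero    (true  ∷ y) _     = refl
weight-toggle-set (suc i) (true  ∷ y) y-i=1 = cong suc (weight-toggle-set i y y-i=1)
weight-toggle-set (suc i) (false ∷ y) y-i=1 = weight-toggle-set i y y-i=1

weight-toggle-≤ : ∀ {n} i (y : Vec Bool n) → weight (toggle i y) ≤ suc (weight y)
weight-toggle-≤ i       []          = z≤n
weight-toggle-≤ zero    (true  ∷ y) = ≤-trans (n≤1+n _) (n≤1+n _)
weight-toggle-≤ zero    (false ∷ y) = ≤-refl
weight-toggle-≤ (suc i) (true  ∷ y) = s≤s (weight-toggle-≤ i y)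
weight-toggle-≤ (suc i) (false ∷ y) = weight-toggle-≤ i y

togglePair : ∀ {n} → ℕ → Vec Bool n → Vec Bool n
togglePair k y = toggle k (toggle (suc k) y)

togglePair-involutive : ∀ {n} k (y : Vec Bool n) → togglePair k (togglePair k y) ≡ y
togglePair-involutive k y = begin
    toggle k (toggle (suc k) (toggle k (toggle (suc k) y)))
  ≡⟨ cong (toggle k) (toggle-comm (suc k) k _) ⟩
    toggle k (toggle k (toggle (suc k) (toggle (suc k) y)))
  ≡⟨ toggle-involutive k _ ⟩
    toggle (suc k) (toggle (suc k) y)
  ≡⟨ toggle-involutive (suc k) y ⟩
    y
  ∎
  where open ≡-Reasoning

togglePair-!ₗ : ∀ {n} k (y : Vec Bool n) → suc k < n → togglePair k y ! k ≡ not (y ! k)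
togglePair-!ₗ k y k+1<n =
  trans (toggle-here k (toggle (suc k) y) (<⇒≤ k+1<n)) (cong not (toggle-there (suc k) k y 1+n≢n))

togglePair-!ᵣ : ∀ {n} k (y : Vec Bool n) → suc k < n → togglePair k y ! suc k ≡ not (y ! suc k)
togglePair-!ᵣ k y k+1<n = trans (toggle-there k (suc k) (toggle (suc k) y) (≢-sym 1+n≢n)) (toggle-here (suc k) y k+1<n)

togglePair-other : ∀ {n} k j (y : Vec Bool n) → k ≢ j → suc k ≢ j → togglePair k y ! j ≡ y ! j
togglePair-other k j y k≢j k+1≢j = trans (toggle-there k j (toggle (suc k) y) k≢j) (toggle-there (suc k) j y k+1≢j)

weight-togglePair-≤ : ∀ {n} k (y : Vec Bool n) → weight (togglePair k y) ≤ 2 + weight y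
weight-togglePair-≤ k y = ≤-trans (weight-toggle-≤ k (toggle (suc k) y)) (s≤s (weight-toggle-≤ (suc k) y))

togglePair-injective : ∀ {n} k k' (y : Vec Bool n) → suc k < n → suc k' < n →
                       togglePair k y ≡ togglePair k' y → k ≡ k'
togglePair-injective k k' y k+1<n k'+1<n same with k ≟ k'
... | yes k≡k' = k≡k'
... | no  k≢k' with k ≟ suc k'
...   | yes refl = ⊥-elim (differ-at k' (togglePair-!ₗ k' y k'+1<n)
                     (togglePair-other (suc k') k' y 1+n≢n (≢-sym (m≢1+n+m k' {1}))) (sym same))
...   | no  k≢k'+1 = ⊥-elim (differ-at k (togglePair-!ₗ k y k+1<n)
                       (togglePair-other k' k y (≢-sym k≢k') (≢-sym k≢k'+1)) same)

togglePair≢toggle : ∀ {n} k i (y : Vec Bool n) → suc k < n → togglePair k y ≢ toggle i y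
togglePair≢toggle k i y k+1<n with i ≟ k
... | yes refl = differ-at (suc i) (togglePair-!ᵣ i y k+1<n) (toggle-there i (suc i) y (≢-sym 1+n≢n))
... | no  i≢k  = differ-at k (togglePair-!ₗ k y k+1<n) (toggle-there i k y i≢k)

diffFrom : ∀ {m} → Bool → Vec Bool m → Vec Bool m
diffFrom p []      = []
diffFrom p (b ∷ v) = (p xor b) ∷ diffFrom b v

undiffFrom : ∀ {m} → Bool → Vec Bool m → Vec Bool m
undiffFrom p []      = []
undiffFrom p (c ∷ w) = (p xor c) ∷ undiffFrom (p xor c) w

toDiff fromDiff : ∀ {m} → Vec Bool m → Vec Bool m
toDiff   = diffFrom false
fromDiff = undiffFrom false

xor-cancelˡ : ∀ p b → p xor (p xor b) ≡ b
xor-cancelˡ p b = trans (sym (xor-assoc p p b)) (cong (_xor b) (xor-same p))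

undiff-diff : ∀ {m} p (x : Vec Bool m) → undiffFrom p (diffFrom p x) ≡ x
undiff-diff p []      = refl
undiff-diff p (b ∷ v) = begin
    (p xor (p xor b)) ∷ undiffFrom (p xor (p xor b)) (diffFrom b v)
  ≡⟨ cong (λ c → c ∷ undiffFrom c (diffFrom b v)) (xor-cancelˡ p b) ⟩
    b ∷ undiffFrom b (diffFrom b v)
  ≡⟨ cong (b ∷_) (undiff-diff b v) ⟩
    b ∷ v
  ∎
  where open ≡-Reasoning

diff-undiff : ∀ {m} p (y : Vec Bool m) → diffFrom p (undiffFrom p y) ≡ y
diff-undiff p []      = refl
diff-undiff p (c ∷ w) = cong₂ _∷_ (xor-cancelˡ p c) (diff-undiff (p xor c) w)

toDiff-injective : ∀ {m} (x x' : Vec Bool m) → toDiff x ≡ toDiff x' → x ≡ x'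
toDiff-injective x x' same =
  trans (sym (undiff-diff false x)) (trans (cong fromDiff same) (undiff-diff false x'))

complementFrom : ∀ {m} → ℕ → Vec Bool m → Vec Bool m
complementFrom zero    v       = map not v
complementFrom (suc i) []      = []
complementFrom (suc i) (b ∷ v) = b ∷ complementFrom i v

diff-complement : ∀ {m} p i (x : Vec Bool m) → diffFrom p (complementFrom i x) ≡ toggle i (diffFrom p x)
diff-complement p zero    []      = refl
diff-complement p zero    (b ∷ v) = cong₂ _∷_ (sym (not-distribʳ-xor p b)) (diff-not b v)
  where
  not-xor-not : ∀ b c → not b xor not c ≡ b xor c
  not-xor-not true  c = refl
  not-xor-not false c = not-involutive c

  diff-not : ∀ {m} b (v : Vec Bool m) → diffFrom (not b) (map not v) ≡ diffFrom b v
  diff-not b []      = refl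
  diff-not b (c ∷ w) = cong₂ _∷_ (not-xor-not b c) (diff-not c w)
diff-complement p (suc i) []      = refl
diff-complement p (suc i) (b ∷ v) = cong ((p xor b) ∷_) (diff-complement b i v)

diff-toggle : ∀ {m} p i (x : Vec Bool m) → diffFrom p (toggle i x) ≡ togglePair i (diffFrom p x)
diff-toggle p i       []      = refl
diff-toggle p zero    (b ∷ v) = cong₂ _∷_ (sym (not-distribʳ-xor p b)) (diff-flipped-start b v)
  where
  diff-flipped-start : ∀ {m} b (v : Vec Bool m) → diffFrom (not b) v ≡ toggle zero (diffFrom b v)
  diff-flipped-start b []      = refl
  diff-flipped-start b (c ∷ w) = cong (_∷ diffFrom c w) (sym (not-distribˡ-xor b c))
diff-toggle p (suc i) (b ∷ v) = cong ((p xor b) ∷_) (diff-toggle b i v)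

toggle-adjacent : ∀ m i (x : Vec Bool m) → i < m → AQ-Adj m x (toggle i x)
toggle-adjacent (suc m) zero    (b ∷ v) _         = inj₂ (not-¬ refl , inj₁ refl)
toggle-adjacent (suc m) (suc i) (b ∷ v) (s≤s i<m) = inj₁ (refl , toggle-adjacent m i v i<m)

complement-adjacent : ∀ m i (x : Vec Bool m) → i < m → AQ-Adj m x (complementFrom i x)
complement-adjacent (suc m) zero    (b ∷ v) _         = inj₂ (not-¬ refl , inj₂ (sym not-not))
  where
  not-not : map not (map not v) ≡ v
  not-not = trans (sym (map-∘ not not v)) (trans (map-cong not-involutive v) (map-id v))
complement-adjacent (suc m) (suc i) (b ∷ v) (s≤s i<m) = inj₁ (refl , complement-adjacent m i v i<m)

-- j lies strictly between k and i when scanning cyclically upward from k.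
Between : ℕ → ℕ → ℕ → Set
Between k i j = (k < j × j < i) ⊎ (i < k × (k < j ⊎ j < i))

between-≢ : ∀ {k i j} → Between k i j → i ≢ j
between-≢ (inj₁ (_ , j<i))        i≡j = <-irrefl (sym i≡j) j<i
between-≢ (inj₂ (i<k , inj₁ k<j)) i≡j = <-irrefl i≡j (<-trans i<k k<j)
between-≢ (inj₂ (_ , inj₂ j<i))   i≡j = <-irrefl (sym i≡j) j<i

between-split : ∀ {k k' i} → k < k' → i ≢ k → i ≢ k' → Between k i k' ⊎ Between k' i k
between-split {k} {k'} {i} k<k' i≢k i≢k' with <-cmp i k
... | tri< i<k _ _ = inj₁ (inj₂ (i<k , inj₁ k<k'))
... | tri≈ _ i≡k _ = ⊥-elim (i≢k i≡k)
... | tri> _ _ k<i with <-cmp i k'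
...   | tri< i<k' _ _ = inj₂ (inj₂ (i<k' , inj₂ k<i))
...   | tri≈ _ i≡k' _ = ⊥-elim (i≢k' i≡k')
...   | tri> _ _ k'<i = inj₁ (inj₁ (k<k' , k'<i))

module CyclicSearch (n : ℕ) where

  scan : Vec Bool n → ℕ → ℕ → Maybe ℕ
  scan y m zero    = nothing
  scan y m (suc c) = if y ! m then just m else scan y (suc m) c

  scan-just : ∀ y m c {i} → scan y m c ≡ just i →
              m ≤ i × i < m + c × y ! i ≡ true × (∀ j → m ≤ j → j < i → y ! j ≡ false)
  scan-just y m (suc c) {i} found with y ! m in y-m
  ... | true with refl ← just-injective found =
        ≤-refl , m<m+n m (s≤s z≤n) , y-m , λ j m≤j j<m → ⊥-elim (≤⇒≯ m≤j j<m)
  ... | false with scan-just y (suc m) c found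
  ...   | m<i , i<end , y-i , gap =
          <⇒≤ m<i , subst (i <_) (sym (+-suc m c)) i<end , y-i , earlier
    where
    earlier : ∀ j → m ≤ j → j < i → y ! j ≡ false
    earlier j m≤j j<i with m ≟ j
    ... | yes refl = y-m
    ... | no  m≢j  = gap j (≤∧≢⇒< m≤j m≢j) j<i

  scan-nothing : ∀ y m c → scan y m c ≡ nothing → ∀ j → m ≤ j → j < m + c → y ! j ≡ false
  scan-nothing y m zero    _ j m≤j j<m = ⊥-elim (≤⇒≯ m≤j (subst (j <_) (+-identityʳ m) j<m))
  scan-nothing y m (suc c) none j m≤j j<end with y ! m in y-m
  ... | false with m ≟ j
  ...   | yes refl = y-m
  ...   | no  m≢j  = scan-nothing y (suc m) c none j (≤∧≢⇒< m≤j m≢j) (subst (j <_) (+-suc m c) j<end)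

  search : ℕ → Vec Bool n → Maybe ℕ
  search k y = scan y (suc k) (n ∸ suc k) <∣> scan y 0 k

  upper-clear : ∀ k y → suc k < n → scan y (suc k) (n ∸ suc k) ≡ nothing →
                ∀ j → k < j → y ! j ≡ false
  upper-clear k y k+1<n none j k<j with j <? n
  ... | yes j<n = scan-nothing y (suc k) (n ∸ suc k) none j k<j
                    (subst (j <_) (sym (m+[n∸m]≡n (<⇒≤ k+1<n))) j<n)
  ... | no  j≮n = !-beyond y j (≮⇒≥ j≮n)

  search-just : ∀ k y {i} → suc k < n → search k y ≡ just i →
                i < n × y ! i ≡ true × i ≢ k × (∀ j → Between k i j → y ! j ≡ false)
  search-just k y k+1<n found with scan y (suc k) (n ∸ suc k) in upper
  ... | just i with refl ← just-injective found with scan-just y (suc k) (n ∸ suc k) upper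
  ...   | k<i , i<end , y-i , gap =
          subst (i <_) (m+[n∸m]≡n (<⇒≤ k+1<n)) i<end , y-i , (λ i≡k → <-irrefl (sym i≡k) k<i) ,
          λ { j (inj₁ (k<j , j<i)) → gap j k<j j<i
            ; j (inj₂ (i<k , _))   → ⊥-elim (<-asym i<k k<i) }
  search-just k y k+1<n found | nothing with scan-just y 0 k found
  ... | _ , i<k , y-i , gap =
        <-trans i<k (<⇒≤ k+1<n) , y-i , (λ i≡k → <-irrefl i≡k i<k) ,
        λ { j (inj₁ (k<j , _))        → upper-clear k y k+1<n upper j k<j
          ; j (inj₂ (_ , inj₁ k<j))   → upper-clear k y k+1<n upper j k<j
          ; j (inj₂ (_ , inj₂ j<i))   → gap j z≤n j<i }

  search-nothing : ∀ k y → suc k < n → search k y ≡ nothing → ∀ j → j ≢ k → y ! j ≡ false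
  search-nothing k y k+1<n none j j≢k with scan y (suc k) (n ∸ suc k) in upper
  ... | nothing with <-cmp j k
  ...   | tri< j<k _ _ = scan-nothing y 0 k none j z≤n j<k
  ...   | tri≈ _ j≡k _ = ⊥-elim (j≢k j≡k)
  ...   | tri> _ _ k<j = upper-clear k y k+1<n upper j k<j

module Trees (n : ℕ) where

  open CyclicSearch n

  V : Set
  V = Vec Bool n

  parent : ℕ → V → Maybe V
  parent k y = if y ! k then Maybe.map (λ i → toggle i y) (search k y) else just (togglePair k y)

  root : ℕ → V
  root k = toggle k (replicate n false)

  -- The penalty 3 for y_k = 0 pays for the pair step, which sets bit k and
  -- raises the weight by at most 2.
  penalty : Bool → ℕ
  penalty true  = 0
  penalty false = 3

  rank : ℕ → V → ℕ
  rank k y = weight y + penalty (y ! k)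

  -- The two kinds of parent step decrease the rank (the right-hand sides are
  -- rank k y, given the value of y_k).
  rank-pair : ∀ k y → suc k < n → y ! k ≡ false → rank k (togglePair k y) < weight y + penalty false
  rank-pair k y k+1<n y-k = begin-strict
      weight (togglePair k y) + penalty (togglePair k y ! k)
    ≡⟨ cong (λ b → weight (togglePair k y) + penalty b) (trans (togglePair-!ₗ k y k+1<n) (cong not y-k)) ⟩
      weight (togglePair k y) + 0
    ≡⟨ +-identityʳ _ ⟩
      weight (togglePair k y)
    ≤⟨ weight-togglePair-≤ k y ⟩
      2 + weight y
    <⟨ n<1+n _ ⟩
      3 + weight y
    ≡⟨ +-comm 3 (weight y) ⟩
      weight y + penalty false
    ∎
    where open ≤-Reasoning

  rank-clear : ∀ k i y → i ≢ k → y ! k ≡ true → y ! i ≡ true → rank k (toggle i y) < weight y + penalty true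
  rank-clear k i y i≢k y-k y-i = begin-strict
      weight (toggle i y) + penalty (toggle i y ! k)
    ≡⟨ cong (λ b → weight (toggle i y) + penalty b) (trans (toggle-there i k y i≢k) y-k) ⟩
      weight (toggle i y) + 0
    ≡⟨ +-identityʳ _ ⟩
      weight (toggle i y)
    <⟨ n<1+n _ ⟩
      suc (weight (toggle i y))
    ≡⟨ weight-toggle-set i y y-i ⟩
      weight y
    ≡⟨ sym (+-identityʳ _) ⟩
      weight y + penalty true
    ∎
    where open ≤-Reasoning

  rank-decreases : ∀ k y {y'} → suc k < n → parent k y ≡ just y' → rank k y' < rank k y
  rank-decreases k y k+1<n found with y ! k in y-k
  ... | false with refl ← just-injective found = rank-pair k y k+1<n y-k
  ... | true with search k y in searched
  ...   | just i with refl ← just-injective found =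
          let (_ , y-i , i≢k , _) = search-just k y k+1<n searched in rank-clear k i y i≢k y-k y-i

  -- Only e_k has no parent: y_k = 1 and the search finds no other set bit.
  orphan-is-root : ∀ k y → suc k < n → parent k y ≡ nothing → y ≡ root k
  orphan-is-root k y k+1<n none with y ! k in y-k
  ... | true with search k y in searched
  ...   | nothing = !-ext y (root k) bit
    where
    bit : ∀ j → y ! j ≡ root k ! j
    bit j with j ≟ k
    ... | yes refl = trans y-k (sym (trans (toggle-here j (replicate n false) (<⇒≤ k+1<n)) (cong not (!-zeros n j))))
    ... | no  j≢k  = trans (search-nothing k y k+1<n searched j j≢k)
                           (sym (trans (toggle-there k j (replicate n false) (≢-sym j≢k)) (!-zeros n j)))

  ClearBetween : ℕ → V → ℕ → Set
  ClearBetween k y i = y ! k ≡ true × (∀ j → Between k i j → y ! j ≡ false)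

  -- The edges of T_k, described without reference to orientation.
  data Link (k : ℕ) (y y' : V) : Set where
    pair-link   : y' ≡ togglePair k y → Link k y y'
    bit-link : ∀ i → y' ≡ toggle i y → i < n → i ≢ k → ClearBetween k y i → Link k y y'

  parent-link : ∀ k y {y'} → suc k < n → parent k y ≡ just y' → Link k y y'
  parent-link k y k+1<n found with y ! k in y-k
  ... | false = pair-link (sym (just-injective found))
  ... | true with search k y in searched
  ...   | just i = let (i<n , _ , i≢k , clear) = search-just k y k+1<n searched
                   in bit-link i (sym (just-injective found)) i<n i≢k (y-k , clear)

  link-sym : ∀ k y y' → Link k y y' → Link k y' y
  link-sym k y _ (pair-link refl) = pair-link (sym (togglePair-involutive k y))
  link-sym k y _ (bit-link i refl i<n i≢k (y-k , clear)) =
    bit-link i (sym (toggle-involutive i y)) i<n i≢k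
      (trans (toggle-there i k y i≢k) y-k ,
       λ j between → trans (toggle-there i j y (between-≢ between)) (clear j between))

  set-and-clear : ∀ {b} → b ≡ true → b ≡ false → ⊥
  set-and-clear refl ()

  clear-between-exclusive : ∀ {k k' i} y → k < k' → i ≢ k → i ≢ k' →
                            ClearBetween k y i → ClearBetween k' y i → ⊥
  clear-between-exclusive y k<k' i≢k i≢k' (y-k , clear) (y-k' , clear') with between-split k<k' i≢k i≢k'
  ... | inj₁ k'-between = set-and-clear y-k' (clear _ k'-between)
  ... | inj₂ k-between  = set-and-clear y-k (clear' _ k-between)

  link-determines-tree : ∀ k k' y y' → suc k < n → suc k' < n → Link k y y' → Link k' y y' → k ≡ k'
  link-determines-tree k k' y y' k+1<n k'+1<n (pair-link p) (pair-link p') =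
    togglePair-injective k k' y k+1<n k'+1<n (trans (sym p) p')
  link-determines-tree k k' y y' k+1<n _ (pair-link p) (bit-link i s _ _ _) =
    ⊥-elim (togglePair≢toggle k i y k+1<n (trans (sym p) s))
  link-determines-tree k k' y y' _ k'+1<n (bit-link i s _ _ _) (pair-link p') =
    ⊥-elim (togglePair≢toggle k' i y k'+1<n (trans (sym p') s))
  link-determines-tree k k' y y' _ _ (bit-link i s i<n i≢k c) (bit-link i' s' _ i'≢k' c')
    with toggle-injective i i' y i<n (trans (sym s) s')
  ... | refl with <-cmp k k'
  ...   | tri< k<k' _ _ = ⊥-elim (clear-between-exclusive y k<k' i≢k i'≢k' c c')
  ...   | tri≈ _ k≡k' _ = k≡k'
  ...   | tri> _ _ k'<k = ⊥-elim (clear-between-exclusive y k'<k i'≢k' i≢k c' c)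

module AQTree (n k : ℕ) (k+1<n : suc k < n) where

  open Trees n

  parentAQ : Vertex n → Maybe (Vertex n)
  parentAQ x = Maybe.map fromDiff (parent k (toDiff x))

  parentAQ-diff : ∀ {x x'} → parentAQ x ≡ just x' → parent k (toDiff x) ≡ just (toDiff x')
  parentAQ-diff {x} found with parent k (toDiff x)
  parentAQ-diff {x} refl | just y = cong just (sym (diff-undiff false y))

  orphanAQ : ∀ x → parentAQ x ≡ nothing → x ≡ fromDiff (root k)
  orphanAQ x none with parent k (toDiff x) in orphan
  ... | nothing = trans (sym (undiff-diff false x)) (cong fromDiff (orphan-is-root k (toDiff x) k+1<n orphan))

  open ParentTree parentAQ (λ x → rank k (toDiff x)) (fromDiff (root k))
                  (λ {x} found → rank-decreases k (toDiff x) k+1<n (parentAQ-diff {x} found)) orphanAQ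

  edge-link : ∀ x x' → Edge x x' → Link k (toDiff x) (toDiff x')
  edge-link x x' (inj₁ x↦x') = parent-link k (toDiff x) k+1<n (parentAQ-diff x↦x')
  edge-link x x' (inj₂ x'↦x) = link-sym k _ _ (parent-link k (toDiff x') k+1<n (parentAQ-diff x'↦x))

  link-adjacent : ∀ x x' → Link k (toDiff x) (toDiff x') → AQ-Adj n x x'
  link-adjacent x x' (pair-link p) =
    subst (AQ-Adj n x) (toDiff-injective (toggle k x) x' (trans (diff-toggle false k x) (sym p)))
          (toggle-adjacent n k x (<⇒≤ k+1<n))
  link-adjacent x x' (bit-link i s i<n _ _) =
    subst (AQ-Adj n x) (toDiff-injective (complementFrom i x) x' (trans (diff-complement false i x) (sym s)))
          (complement-adjacent n i x i<n)

  tree : SpanningSubgraph n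
  tree = record { E = Edge ; sym = Edge-sym ; edgesOK = λ x x' e → link-adjacent x x' (edge-link x x' e) }

  tree-spanning : IsSpanningTree tree
  tree-spanning = connected , λ (a , b , c , rest , distinct , walk) → acyclic a b c rest distinct walk

index-bound : ∀ {n} (i : Fin (n ∸ 1)) → suc (toℕ i) < n
index-bound {suc n} i = s≤s (toℕ<n i)

trees : (n : ℕ) → Fin (n ∸ 1) → SpanningSubgraph n
trees n i = AQTree.tree n (toℕ i) (index-bound i)

trees-disjoint : ∀ n → EdgeDisjoint (trees n)
trees-disjoint n i j i≢j x x' in-i in-j =
  i≢j (toℕ-injective (link-determines-tree (toℕ i) (toℕ j) _ _ (index-bound i) (index-bound j)
        (AQTree.edge-link n (toℕ i) (index-bound i) x x' in-i)
        (AQTree.edge-link n (toℕ j) (index-bound j) x x' in-j)))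
  where open Trees n

-- The construction works for every n.
theorem1 : (n : ℕ) → 3 ≤ n →
    Σ (Fin (n ∸ 1) → SpanningSubgraph n) λ T →
      ((i : Fin (n ∸ 1)) → IsSpanningTree (T i)) × EdgeDisjoint T
theorem1 n _ =
  trees n , (λ i → AQTree.tree-spanning n (toℕ i) (index-bound i)) , trees-disjoint n
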